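{- Let $G$ be a finite graph and let $M_1,\dots,M_k$ be the maximal stable partitions of $G$. Then $$X_G = \sum_{\emptyset \neq S \subseteq [k]} (-1)^{|S|-1}\, r_{\lambda\left(\bigwedge_{i\in S} M_i\right)}.$$
   Context: A maximal stable partition of $G$ is a set partition $\pi$ of $V(G)$ such that no edge of $G$ has both endpoints in the same block of $\pi$ and there is at least one edge of $G$ between every pair of distinct blocks of $\pi$. For set partitions $\pi,\rho$, $\pi\wedge\rho$ is the partition in which two elements are in the same block iff they are in the same block in both $\pi$ and $\rho$; $\lambda(\pi)$ is the integer partition of block sizes of $\pi$. The chromatic symmetric function of a graph $H$ is $X_H = \sum_\kappa \prod_{v\in V(H)} x_{\kappa(v)}$ over proper colorings $\kappa: V(H)\to\mathbb{N}$. For an integer partition $\lambda=(\lambda_1,\dots,\lambda_k)$, $G_\lambda$ is the complete multipartite graph with stable sets of sizes $\lambda_1,\dots,\lambda_k$ and all edges between different stable sets, and $r_\lambda = X_{G_\lambda}$. $[k]=\{1,\dots,k\}$. -}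

module Defs where

open import Data.Bool using (Bool; true; false; not; _∧_; if_then_else_)
open import Data.Nat using (ℕ; zero; suc; _≡ᵇ_; _<ᵇ_; _≥_)
open import Data.Fin using (Fin; toℕ; splitAt)
open import Data.Sum using (inj₁; inj₂)
open import Data.List using (List; []; _∷_; map; concatMap; allFin; filterᵇ; length; foldr)
open import Data.Bool.ListAction using (all; any)
open import Data.Nat.ListAction using (sum)
open import Data.Vec.Functional using () renaming (_∷_ to _◂_)
open import Data.Integer using (ℤ; +_; -_; _*_; _+_)
open import Data.Product using (∃; ∃₂; _×_)
open import Relation.Binary.PropositionalEquality using (_≡_)

record Graph (m : ℕ) : Set where
  field
    adj       : Fin m → Fin m → Bool
    adj-sym   : ∀ u v → adj u v ≡ adj v u
    adj-irrefl : ∀ u → adj u u ≡ false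
open Graph public

record SetPartition (m : ℕ) : Set where
  field
    same       : Fin m → Fin m → Bool
    same-refl  : ∀ u → same u u ≡ true
    same-sym   : ∀ u v → same u v ≡ same v u
    same-trans : ∀ u v w → same u v ≡ true → same v w ≡ true → same u w ≡ true
open SetPartition public

_≈P_ : ∀ {m} → SetPartition m → SetPartition m → Set
π ≈P ρ = ∀ u v → same π u v ≡ same ρ u v

IsMaxStablePartition : ∀ {m} → Graph m → SetPartition m → Set
IsMaxStablePartition G π =
  (∀ u v → same π u v ≡ true → adj G u v ≡ false) ×
  (∀ u v → same π u v ≡ false →
     ∃₂ λ x y → same π u x ≡ true × same π v y ≡ true × adj G x y ≡ true)

allFunctions : (N n : ℕ) → List (Fin N → Fin n)
allFunctions zero    n = (λ ()) ∷ []
allFunctions (suc N) n =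
  concatMap (λ c → map (λ f → c ◂ f) (allFunctions N n)) (allFin n)

Subset : ℕ → Set
Subset k = Fin k → Bool

allSubsets : (k : ℕ) → List (Subset k)
allSubsets zero    = (λ ()) ∷ []
allSubsets (suc k) =
  concatMap (λ b → map (λ S → b ◂ S) (allSubsets k)) (true ∷ false ∷ [])

card : ∀ {k} → Subset k → ℕ
card {k} S = length (filterᵇ S (allFin k))

-- meet of the partitions M i, i ∈ S  (S assumed nonempty where used)
meet : ∀ {m k} → (Fin k → SetPartition m) → Subset k → Fin m → Fin m → Bool
meet {m} {k} M S u v = all (λ i → if S i then same (M i) u v else true) (allFin k)

-- λ(π): the multiset of block sizes, listed once per block (at the block's
-- least element).  Given as a raw relation so it applies to meets.

blockSizes : ∀ {m} → (Fin m → Fin m → Bool) → List ℕ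
blockSizes {m} R =
  map (λ u → length (filterᵇ (R u) (allFin m)))
      (filterᵇ (λ u → not (any (λ v → (toℕ v <ᵇ toℕ u) ∧ R v u) (allFin m))) (allFin m))

-- Complete multipartite graph G_λ on vertex set Fin (λ₁ + ... + λ_l):
-- vertex i lies in stable set number partOf λ i.

partOf : (λs : List ℕ) → Fin (sum λs) → ℕ
partOf []       ()
partOf (p ∷ ps) i with splitAt p i
... | inj₁ _ = 0
... | inj₂ j = suc (partOf ps j)

multipartiteAdj : (λs : List ℕ) → Fin (sum λs) → Fin (sum λs) → Bool
multipartiteAdj λs u v = not (partOf λs u ≡ᵇ partOf λs v)

-- Chromatic symmetric function, via its coefficients.
-- X_H = Σ_κ Π_v x_{κ(v)}; the coefficient of the monomial
-- x_0^{a 0} ⋯ x_{n-1}^{a (n-1)} is the number of proper colourings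
-- κ : V(H) → Fin n with |κ⁻¹(i)| = a i for all i.

countEq : ∀ {N n} → (Fin N → Fin n) → Fin n → ℕ
countEq {N} κ i = length (filterᵇ (λ v → toℕ (κ v) ≡ᵇ toℕ i) (allFin N))

isProper : ∀ {N n} → (Fin N → Fin N → Bool) → (Fin N → Fin n) → Bool
isProper {N} A κ =
  all (λ u → all (λ v → not (A u v ∧ (toℕ (κ u) ≡ᵇ toℕ (κ v)))) (allFin N)) (allFin N)

hasType : ∀ {N n} → (Fin n → ℕ) → (Fin N → Fin n) → Bool
hasType {N} {n} a κ = all (λ i → countEq κ i ≡ᵇ a i) (allFin n)

coeffX : ∀ {N} → (Fin N → Fin N → Bool) → (n : ℕ) → (Fin n → ℕ) → ℕ
coeffX {N} A n a = length (filterᵇ (λ κ → isProper A κ ∧ hasType a κ) (allFunctions N n))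

-- coefficient of x^a in r_λ = X_{G_λ}
coeffR : List ℕ → (n : ℕ) → (Fin n → ℕ) → ℕ
coeffR λs n a = coeffX (multipartiteAdj λs) n a

signPred : ℕ → ℤ
signPred zero          = + 1   -- unused (S nonempty)
signPred (suc zero)    = + 1
signPred (suc (suc j)) = - signPred (suc j)

coeffRHS : ∀ {m k} → (Fin k → SetPartition m) → (n : ℕ) → (Fin n → ℕ) → ℤ
coeffRHS {m} {k} M n a =
  foldr _+_ (+ 0)
    (map (λ S → signPred (card S) * + coeffR (blockSizes (meet M S)) n a)
         (filterᵇ (λ S → not (card S ≡ᵇ 0)) (allSubsets k)))

{-# OPTIONS --safe #-}

-- Compare coefficients: both sides count colourings κ of a fixed type.  Relabelling the
-- vertices block by block identifies G_λ(π) with the graph joining the vertices in distinct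
-- blocks of π, so r_λ(π) counts the colourings whose colour classes refine π.  A colouring
-- refining a stable partition is proper for G; conversely, grouping the colour classes of a
-- proper colouring greedily (first fit, never putting two classes joined by an edge into one
-- group) yields a maximal stable partition coarser than κ, that is, some M i.  Hence, by
-- inclusion–exclusion, the right-hand side counts each κ with weight
--   Σ_{∅≠S⊆[k]} (-1)^{|S|-1} [κ refines M i for all i ∈ S] = [κ refines some M i] = [κ proper].
module Submission where

open import Algebra.Structures using (IsCommutativeMonoid)
open import Data.Bool using (Bool; true; false; not; _∧_; _∨_; if_then_else_)
open import Data.Bool.ListAction using (all; any; and)
open import Data.Bool.Properties using (∧-conicalˡ; ∧-conicalʳ; ∧-zeroʳ; ∧-identityʳ; T-≡)
open import Data.Empty using (⊥; ⊥-elim)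
open import Data.Fin using (Fin; toℕ; splitAt; _↑ˡ_; _↑ʳ_) renaming (zero to fz; suc to fs)
open import Data.Fin.Properties using (toℕ-injective; suc-injective; splitAt-↑ˡ; splitAt-↑ʳ)
open import Data.Integer as ℤ using (ℤ; +_; -_)
import Data.Integer.Properties as ℤP
open import Data.List using (List; []; _∷_; map; concatMap; allFin; filterᵇ; length; foldr; tabulate; lookup; _++_)
open import Data.List.Membership.Propositional using (_∈_)
open import Data.List.Membership.Propositional.Properties using (∈-lookup; ∈-filter⁻)
open import Data.List.Properties using (map-cong)
open import Data.List.Relation.Unary.All as All using ()
open import Data.List.Relation.Unary.AllPairs using (AllPairs; []; _∷_)
open import Data.List.Relation.Unary.Any using (here; there)
open import Data.List.Relation.Unary.Unique.Propositional using (Unique)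
import Data.List.Relation.Unary.Unique.Propositional.Properties as Unique
open import Data.Nat as ℕ using (ℕ; zero; suc; _≡ᵇ_; _<ᵇ_; _<_; _≤_; z≤n; s≤s)
open import Data.Nat.ListAction using (sum)
open import Data.Nat.Properties as ℕP using (*-identityʳ; *-zeroʳ; +-identityʳ; ≡ᵇ⇒≡; ≡⇒≡ᵇ; <ᵇ⇒<; <⇒<ᵇ)
open import Data.Product using (∃; ∃₂; _×_; _,_; proj₁; proj₂)
open import Data.Sum using (inj₁; inj₂)
open import Data.Vec.Functional using () renaming (_∷_ to _◂_)
open import Function using (_∘_; id; Equivalence)
open import Relation.Binary.Definitions using (tri<; tri≈; tri>)
open import Relation.Binary.PropositionalEquality hiding ([_])
open import Relation.Nullary.Decidable using (T?)

open import Defs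

open Equivalence using (to; from)

[_] : Bool → ℕ
[ true ]  = 1
[ false ] = 0

[∧]≡[]*[] : ∀ a b → [ a ∧ b ] ≡ [ a ] ℕ.* [ b ]
[∧]≡[]*[] true  b = sym (ℕP.+-identityʳ [ b ])
[∧]≡[]*[] false b = refl

bool-ext : ∀ {b c : Bool} → (b ≡ true → c ≡ true) → (c ≡ true → b ≡ true) → b ≡ c
bool-ext {true}  {true}  _ _ = refl
bool-ext {true}  {false} f _ = sym (f refl)
bool-ext {false} {true}  _ g = g refl
bool-ext {false} {false} _ _ = refl

true≢false : true ≢ false
true≢false ()

not-true : ∀ {b} → not b ≡ true → b ≡ false
not-true {false} _ = refl

not-false : ∀ {b} → not b ≡ false → b ≡ true
not-false {true} _ = refl

≡ᵇ-true⇒≡ : ∀ m n → (m ≡ᵇ n) ≡ true → m ≡ n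
≡ᵇ-true⇒≡ m n = ≡ᵇ⇒≡ m n ∘ from T-≡

≡⇒≡ᵇ-true : ∀ m n → m ≡ n → (m ≡ᵇ n) ≡ true
≡⇒≡ᵇ-true m n = to T-≡ ∘ ≡⇒≡ᵇ m n

≡ᵇ-refl : ∀ m → (m ≡ᵇ m) ≡ true
≡ᵇ-refl m = ≡⇒≡ᵇ-true m m refl

≢⇒≡ᵇ-false : ∀ {m n} → m ≢ n → (m ≡ᵇ n) ≡ false
≢⇒≡ᵇ-false {m} {n} m≢n with m ≡ᵇ n in eq
... | true  = ⊥-elim (m≢n (≡ᵇ-true⇒≡ m n eq))
... | false = refl

<ᵇ-true⇒< : ∀ {m n} → (m <ᵇ n) ≡ true → m < n
<ᵇ-true⇒< {m} {n} = <ᵇ⇒< m n ∘ from T-≡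

<⇒<ᵇ-true : ∀ {m n} → m < n → (m <ᵇ n) ≡ true
<⇒<ᵇ-true = to T-≡ ∘ <⇒<ᵇ

-- Written as in countEq and isProper, which therefore unfold to it.
_==_ : ∀ {n} → Fin n → Fin n → Bool
a == b = toℕ a ≡ᵇ toℕ b

==-true⇒≡ : ∀ {n} {a b : Fin n} → a == b ≡ true → a ≡ b
==-true⇒≡ {a = a} {b} = toℕ-injective ∘ ≡ᵇ-true⇒≡ (toℕ a) (toℕ b)

==-refl : ∀ {n} (a : Fin n) → a == a ≡ true
==-refl a = ≡ᵇ-refl (toℕ a)

≢⇒==-false : ∀ {n} {a b : Fin n} → a ≢ b → a == b ≡ false
≢⇒==-false a≢b = ≢⇒≡ᵇ-false (a≢b ∘ toℕ-injective)

all-tabulate⁻ : ∀ {n} {X : Set} (p : X → Bool) (g : Fin n → X) →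
                all p (tabulate g) ≡ true → ∀ i → p (g i) ≡ true
all-tabulate⁻ p g e fz     = ∧-conicalˡ _ _ e
all-tabulate⁻ p g e (fs i) = all-tabulate⁻ p (g ∘ fs) (∧-conicalʳ _ _ e) i

all-tabulate⁺ : ∀ {n} {X : Set} (p : X → Bool) (g : Fin n → X) →
                (∀ i → p (g i) ≡ true) → all p (tabulate g) ≡ true
all-tabulate⁺ {zero}  p g h = refl
all-tabulate⁺ {suc n} p g h rewrite h fz = all-tabulate⁺ p (g ∘ fs) (h ∘ fs)

any-tabulate⁻ : ∀ {n} {X : Set} (p : X → Bool) (g : Fin n → X) →
                any p (tabulate g) ≡ true → ∃ λ i → p (g i) ≡ true
any-tabulate⁻ {suc n} p g e with p (g fz) in eq
... | true  = fz , eq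
... | false = let (i , q) = any-tabulate⁻ p (g ∘ fs) e in fs i , q

any-tabulate⁺ : ∀ {n} {X : Set} (p : X → Bool) (g : Fin n → X) i →
                p (g i) ≡ true → any p (tabulate g) ≡ true
any-tabulate⁺ p g fz     e rewrite e = refl
any-tabulate⁺ p g (fs i) e with p (g fz)
... | true  = refl
... | false = any-tabulate⁺ p (g ∘ fs) i e

all-allFin⁻ : ∀ {n} (p : Fin n → Bool) → all p (allFin n) ≡ true → ∀ i → p i ≡ true
all-allFin⁻ p = all-tabulate⁻ p id

all-allFin⁺ : ∀ {n} (p : Fin n → Bool) → (∀ i → p i ≡ true) → all p (allFin n) ≡ true
all-allFin⁺ p = all-tabulate⁺ p id

any-allFin⁻ : ∀ {n} (p : Fin n → Bool) → any p (allFin n) ≡ true → ∃ λ i → p i ≡ true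
any-allFin⁻ p = any-tabulate⁻ p id

any-allFin⁺ : ∀ {n} (p : Fin n → Bool) i → p i ≡ true → any p (allFin n) ≡ true
any-allFin⁺ p = any-tabulate⁺ p id

-- Finite sums

module FiniteSums {A : Set} {_⊕_ : A → A → A} {ε : A} (isCM : IsCommutativeMonoid _≡_ _⊕_ ε) where

  open IsCommutativeMonoid isCM using (assoc; comm; identityˡ; identityʳ)

  ∑Fin : ∀ {n} → (Fin n → A) → A
  ∑Fin {zero}  f = ε
  ∑Fin {suc n} f = f fz ⊕ ∑Fin (f ∘ fs)

  ∑List : ∀ {X : Set} → List X → (X → A) → A
  ∑List []       f = ε
  ∑List (x ∷ xs) f = f x ⊕ ∑List xs f

  ∑Fun : ∀ N n → ((Fin N → Fin n) → A) → A
  ∑Fun zero    n h = h (λ ())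
  ∑Fun (suc N) n h = ∑Fin (λ c → ∑Fun N n (λ g → h (c ◂ g)))

  record Summation (X : Set) : Set where
    field
      ∑    : (X → A) → A
      ∑-cong : ∀ {f g} → (∀ x → f x ≡ g x) → ∑ f ≡ ∑ g
      ∑-ε  : ∑ (λ _ → ε) ≡ ε
      ∑-⊕  : ∀ f g → ∑ (λ x → f x ⊕ g x) ≡ ∑ f ⊕ ∑ g
  open Summation public

  ⊕-interchange : ∀ a b c d → (a ⊕ b) ⊕ (c ⊕ d) ≡ (a ⊕ c) ⊕ (b ⊕ d)
  ⊕-interchange a b c d = begin
    (a ⊕ b) ⊕ (c ⊕ d)   ≡⟨ assoc a b (c ⊕ d) ⟩
    a ⊕ (b ⊕ (c ⊕ d))   ≡⟨ cong (a ⊕_) (sym (assoc b c d)) ⟩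
    a ⊕ ((b ⊕ c) ⊕ d)   ≡⟨ cong (λ z → a ⊕ (z ⊕ d)) (comm b c) ⟩
    a ⊕ ((c ⊕ b) ⊕ d)   ≡⟨ cong (a ⊕_) (assoc c b d) ⟩
    a ⊕ (c ⊕ (b ⊕ d))   ≡⟨ sym (assoc a c (b ⊕ d)) ⟩
    (a ⊕ c) ⊕ (b ⊕ d)   ∎
    where open ≡-Reasoning

  ∑Fin-cong : ∀ {n} {f g : Fin n → A} → (∀ x → f x ≡ g x) → ∑Fin f ≡ ∑Fin g
  ∑Fin-cong {zero}  e = refl
  ∑Fin-cong {suc n} e = cong₂ _⊕_ (e fz) (∑Fin-cong (e ∘ fs))

  ∑Fin-ε : ∀ {n} → ∑Fin {n} (λ _ → ε) ≡ ε
  ∑Fin-ε {zero}  = refl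
  ∑Fin-ε {suc n} = trans (cong (ε ⊕_) (∑Fin-ε {n})) (identityˡ ε)

  ∑Fin-⊕ : ∀ {n} (f g : Fin n → A) → ∑Fin (λ x → f x ⊕ g x) ≡ ∑Fin f ⊕ ∑Fin g
  ∑Fin-⊕ {zero}  f g = sym (identityˡ ε)
  ∑Fin-⊕ {suc n} f g = trans (cong (_ ⊕_) (∑Fin-⊕ (f ∘ fs) (g ∘ fs))) (⊕-interchange _ _ _ _)

  finSummation : ∀ n → Summation (Fin n)
  finSummation n = record { ∑ = ∑Fin ; ∑-cong = ∑Fin-cong ; ∑-ε = ∑Fin-ε {n} ; ∑-⊕ = ∑Fin-⊕ }

  ∑List-cong : ∀ {X} (xs : List X) {f g : X → A} → (∀ x → f x ≡ g x) → ∑List xs f ≡ ∑List xs g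
  ∑List-cong []       e = refl
  ∑List-cong (x ∷ xs) e = cong₂ _⊕_ (e x) (∑List-cong xs e)

  ∑List-ε : ∀ {X} (xs : List X) → ∑List xs (λ _ → ε) ≡ ε
  ∑List-ε []       = refl
  ∑List-ε (x ∷ xs) = trans (cong (ε ⊕_) (∑List-ε xs)) (identityˡ ε)

  ∑List-⊕ : ∀ {X} (xs : List X) (f g : X → A) → ∑List xs (λ x → f x ⊕ g x) ≡ ∑List xs f ⊕ ∑List xs g
  ∑List-⊕ []       f g = sym (identityˡ ε)
  ∑List-⊕ (x ∷ xs) f g = trans (cong (_ ⊕_) (∑List-⊕ xs f g)) (⊕-interchange _ _ _ _)

  ∑Fun-cong : ∀ N n {f g : (Fin N → Fin n) → A} → (∀ x → f x ≡ g x) → ∑Fun N n f ≡ ∑Fun N n g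
  ∑Fun-cong zero    n e = e _
  ∑Fun-cong (suc N) n e = ∑Fin-cong (λ c → ∑Fun-cong N n (λ g → e (c ◂ g)))

  ∑Fun-ε : ∀ N n → ∑Fun N n (λ _ → ε) ≡ ε
  ∑Fun-ε zero    n = refl
  ∑Fun-ε (suc N) n = trans (∑Fin-cong {n} (λ c → ∑Fun-ε N n)) (∑Fin-ε {n})

  ∑Fun-⊕ : ∀ N n f g → ∑Fun N n (λ x → f x ⊕ g x) ≡ ∑Fun N n f ⊕ ∑Fun N n g
  ∑Fun-⊕ zero    n f g = refl
  ∑Fun-⊕ (suc N) n f g =
    trans (∑Fin-cong (λ c → ∑Fun-⊕ N n (λ h → f (c ◂ h)) (λ h → g (c ◂ h)))) (∑Fin-⊕ {n} _ _)

  funSummation : ∀ N n → Summation (Fin N → Fin n)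
  funSummation N n = record { ∑ = ∑Fun N n ; ∑-cong = ∑Fun-cong N n ; ∑-ε = ∑Fun-ε N n ; ∑-⊕ = ∑Fun-⊕ N n }

  module _ {Y : Set} (S : Summation Y) where

    ∑Fin-swap : ∀ {n} (h : Fin n → Y → A) → ∑Fin (λ i → ∑ S (h i)) ≡ ∑ S (λ y → ∑Fin (λ i → h i y))
    ∑Fin-swap {zero}  h = sym (∑-ε S)
    ∑Fin-swap {suc n} h = trans (cong (_ ⊕_) (∑Fin-swap (h ∘ fs))) (sym (∑-⊕ S _ _))

    ∑List-swap : ∀ {X} (xs : List X) (h : X → Y → A) →
                 ∑List xs (λ x → ∑ S (h x)) ≡ ∑ S (λ y → ∑List xs (λ x → h x y))
    ∑List-swap []       h = sym (∑-ε S)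
    ∑List-swap (x ∷ xs) h = trans (cong (_ ⊕_) (∑List-swap xs h)) (sym (∑-⊕ S _ _))

    ∑Fun-swap : ∀ N n (h : (Fin N → Fin n) → Y → A) →
                ∑Fun N n (λ κ → ∑ S (h κ)) ≡ ∑ S (λ y → ∑Fun N n (λ κ → h κ y))
    ∑Fun-swap zero    n h = refl
    ∑Fun-swap (suc N) n h = trans (∑Fin-cong (λ c → ∑Fun-swap N n (λ g → h (c ◂ g)))) (∑Fin-swap {n} _)

  ∑Fin-+ : ∀ p q (h : Fin (p ℕ.+ q) → A) → ∑Fin h ≡ ∑Fin (λ i → h (i ↑ˡ q)) ⊕ ∑Fin (λ i → h (p ↑ʳ i))
  ∑Fin-+ zero    q h = sym (identityˡ _)
  ∑Fin-+ (suc p) q h = trans (cong (_ ⊕_) (∑Fin-+ p q (h ∘ fs))) (sym (assoc _ _ _))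

  ∑List-++ : ∀ {X} (xs ys : List X) f → ∑List (xs ++ ys) f ≡ ∑List xs f ⊕ ∑List ys f
  ∑List-++ []       ys f = sym (identityˡ _)
  ∑List-++ (x ∷ xs) ys f = trans (cong (_ ⊕_) (∑List-++ xs ys f)) (sym (assoc _ _ _))

  ∑List-map : ∀ {X Y} (g : X → Y) (xs : List X) f → ∑List (map g xs) f ≡ ∑List xs (f ∘ g)
  ∑List-map g []       f = refl
  ∑List-map g (x ∷ xs) f = cong (_ ⊕_) (∑List-map g xs f)

  ∑List-concatMap : ∀ {X Y} (g : X → List Y) (xs : List X) f →
                    ∑List (concatMap g xs) f ≡ ∑List xs (λ x → ∑List (g x) f)
  ∑List-concatMap g []       f = refl
  ∑List-concatMap g (x ∷ xs) f = trans (∑List-++ (g x) (concatMap g xs) f) (cong (_ ⊕_) (∑List-concatMap g xs f))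

  ∑List-tabulate : ∀ {n} {X} (g : Fin n → X) f → ∑List (tabulate g) f ≡ ∑Fin (f ∘ g)
  ∑List-tabulate {zero}  g f = refl
  ∑List-tabulate {suc n} g f = cong (_ ⊕_) (∑List-tabulate (g ∘ fs) f)

  ∑List-allFin : ∀ n f → ∑List (allFin n) f ≡ ∑Fin f
  ∑List-allFin n = ∑List-tabulate id

  ∑List-allFunctions : ∀ N n f → ∑List (allFunctions N n) f ≡ ∑Fun N n f
  ∑List-allFunctions zero    n f = identityʳ _
  ∑List-allFunctions (suc N) n f = begin
    ∑List (concatMap (λ c → map (c ◂_) (allFunctions N n)) (allFin n)) f
      ≡⟨ ∑List-concatMap _ (allFin n) f ⟩
    ∑List (allFin n) (λ c → ∑List (map (c ◂_) (allFunctions N n)) f)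
      ≡⟨ ∑List-allFin n _ ⟩
    ∑Fin (λ c → ∑List (map (c ◂_) (allFunctions N n)) f)
      ≡⟨ ∑Fin-cong (λ c → trans (∑List-map (c ◂_) (allFunctions N n) f) (∑List-allFunctions N n _)) ⟩
    ∑Fun (suc N) n f ∎
    where open ≡-Reasoning

  ∑List≡foldr : ∀ {X} (xs : List X) f → ∑List xs f ≡ foldr _⊕_ ε (map f xs)
  ∑List≡foldr []       f = refl
  ∑List≡foldr (x ∷ xs) f = cong (f x ⊕_) (∑List≡foldr xs f)

  ∑List-filterᵇ : ∀ {X} (p : X → Bool) (xs : List X) f →
                  ∑List (filterᵇ p xs) f ≡ ∑List xs (λ x → if p x then f x else ε)
  ∑List-filterᵇ p []       f = refl
  ∑List-filterᵇ p (x ∷ xs) f with p x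
  ... | true  = cong (_ ⊕_) (∑List-filterᵇ p xs f)
  ... | false = trans (∑List-filterᵇ p xs f) (sym (identityˡ _))

open FiniteSums ℕP.+-0-isCommutativeMonoid

module ℤ∑ = FiniteSums ℤP.+-0-isCommutativeMonoid

module SumHomomorphism {A B : Set} {_⊕_ : A → A → A} {ε : A} {_⊞_ : B → B → B} {ο : B}
  (isA : IsCommutativeMonoid _≡_ _⊕_ ε) (isB : IsCommutativeMonoid _≡_ _⊞_ ο)
  (φ : A → B) (φ-ε : φ ε ≡ ο) (φ-⊕ : ∀ x y → φ (x ⊕ y) ≡ φ x ⊞ φ y) where

  private
    module A∑ = FiniteSums isA
    module B∑ = FiniteSums isB

  ∑Fin-hom : ∀ {n} (f : Fin n → A) → φ (A∑.∑Fin f) ≡ B∑.∑Fin (φ ∘ f)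
  ∑Fin-hom {zero}  f = φ-ε
  ∑Fin-hom {suc n} f = trans (φ-⊕ (f fz) _) (cong (φ (f fz) ⊞_) (∑Fin-hom (f ∘ fs)))

  ∑Fun-hom : ∀ N n (h : (Fin N → Fin n) → A) → φ (A∑.∑Fun N n h) ≡ B∑.∑Fun N n (φ ∘ h)
  ∑Fun-hom zero    n h = refl
  ∑Fun-hom (suc N) n h = trans (∑Fin-hom {n} _) (B∑.∑Fin-cong (λ c → ∑Fun-hom N n (λ g → h (c ◂ g))))

module pos-hom = SumHomomorphism ℕP.+-0-isCommutativeMonoid ℤP.+-0-isCommutativeMonoid +_ refl ℤP.pos-+

module scale-hom (c : ℤ) =
  SumHomomorphism ℤP.+-0-isCommutativeMonoid ℤP.+-0-isCommutativeMonoid (c ℤ.*_) (ℤP.*-zeroʳ c) (ℤP.*-distribˡ-+ c)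

-- Counting and double counting

length-filterᵇ : ∀ {X : Set} (p : X → Bool) (xs : List X) → length (filterᵇ p xs) ≡ ∑List xs ([_] ∘ p)
length-filterᵇ p []       = refl
length-filterᵇ p (x ∷ xs) with p x
... | true  = cong suc (length-filterᵇ p xs)
... | false = length-filterᵇ p xs

count-allFin : ∀ N (p : Fin N → Bool) → length (filterᵇ p (allFin N)) ≡ ∑Fin ([_] ∘ p)
count-allFin N p = trans (length-filterᵇ p (allFin N)) (∑List-allFin N _)

count-allFunctions : ∀ N n (p : (Fin N → Fin n) → Bool) →
                     length (filterᵇ p (allFunctions N n)) ≡ ∑Fun N n ([_] ∘ p)
count-allFunctions N n p = trans (length-filterᵇ p (allFunctions N n)) (∑List-allFunctions N n _)

∑-*ˡ : ∀ {Y} (S : Summation Y) c f → ∑ S (λ y → c ℕ.* f y) ≡ c ℕ.* ∑ S f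
∑-*ˡ S zero    f = ∑-ε S
∑-*ˡ S (suc c) f = trans (∑-⊕ S f (λ y → c ℕ.* f y)) (cong (∑ S f ℕ.+_) (∑-*ˡ S c f))

∑-bijective-relation :
  ∀ {X Y} (SX : Summation X) (SY : Summation Y) →
  (∀ (h : X → Y → ℕ) → ∑ SX (λ x → ∑ SY (h x)) ≡ ∑ SY (λ y → ∑ SX (λ x → h x y))) →
  (R : X → Y → Bool) → (∀ x → ∑ SY (λ y → [ R x y ]) ≡ 1) → (∀ y → ∑ SX (λ x → [ R x y ]) ≡ 1) →
  {p : X → ℕ} {q : Y → ℕ} → (∀ x y → R x y ≡ true → p x ≡ q y) → ∑ SX p ≡ ∑ SY q
∑-bijective-relation SX SY swap R R-x R-y {p} {q} R⇒p≡q = begin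
  ∑ SX p                                          ≡⟨ ∑-cong SX (λ x → sym (weigh SY (p x) (R-x x))) ⟩
  ∑ SX (λ x → ∑ SY (λ y → p x ℕ.* [ R x y ]))   ≡⟨ swap _ ⟩
  ∑ SY (λ y → ∑ SX (λ x → p x ℕ.* [ R x y ]))   ≡⟨ ∑-cong SY (λ y → ∑-cong SX (λ x → move x y)) ⟩
  ∑ SY (λ y → ∑ SX (λ x → q y ℕ.* [ R x y ]))   ≡⟨ ∑-cong SY (λ y → weigh SX (q y) (R-y y)) ⟩
  ∑ SY q                                          ∎
  where
  open ≡-Reasoning
  weigh : ∀ {Z} (S : Summation Z) {w : Z → ℕ} c → ∑ S w ≡ 1 → ∑ S (λ z → c ℕ.* w z) ≡ c
  weigh S {w} c ∑w≡1 = trans (∑-*ˡ S c w) (trans (cong (c ℕ.*_) ∑w≡1) (*-identityʳ c))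
  move : ∀ x y → p x ℕ.* [ R x y ] ≡ q y ℕ.* [ R x y ]
  move x y with R x y in eq
  ... | true  = cong (ℕ._* 1) (R⇒p≡q x y eq)
  ... | false = trans (*-zeroʳ (p x)) (sym (*-zeroʳ (q y)))

∑Fin-delta : ∀ {n} (h : Fin n → ℕ) (u : Fin n) → (∀ x → x ≢ u → h x ≡ 0) → ∑Fin h ≡ h u
∑Fin-delta {suc n} h fz     h≡0 =
  trans (cong (h fz ℕ.+_) (trans (∑Fin-cong (λ x → h≡0 (fs x) λ ())) (∑Fin-ε {n}))) (+-identityʳ _)
∑Fin-delta {suc n} h (fs u) h≡0 =
  trans (cong (ℕ._+ ∑Fin (h ∘ fs)) (h≡0 fz λ ()))
        (∑Fin-delta (h ∘ fs) u (λ x x≢u → h≡0 (fs x) (x≢u ∘ suc-injective)))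

∑Fin-[==] : ∀ {n} (u : Fin n) → ∑Fin (λ x → [ x == u ]) ≡ 1
∑Fin-[==] u = trans (∑Fin-delta _ u (λ x x≢u → cong [_] (≢⇒==-false x≢u))) (cong [_] (==-refl u))

∑Fin-[]≡0⇒false : ∀ {n} (p : Fin n → Bool) → ∑Fin ([_] ∘ p) ≡ 0 → ∀ x → p x ≡ false
∑Fin-[]≡0⇒false p ∑≡0 fz     with p fz
∑Fin-[]≡0⇒false p ()  fz     | true
∑Fin-[]≡0⇒false p ∑≡0 fz     | false = refl
∑Fin-[]≡0⇒false p ∑≡0 (fs x) with p fz
∑Fin-[]≡0⇒false p ()  (fs x) | true
∑Fin-[]≡0⇒false p ∑≡0 (fs x) | false = ∑Fin-[]≡0⇒false (p ∘ fs) ∑≡0 x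

∑Fin-[]≡1⇒∃ : ∀ {n} (p : Fin n → Bool) → ∑Fin ([_] ∘ p) ≡ 1 → ∃ λ x → p x ≡ true
∑Fin-[]≡1⇒∃ {suc n} p ∑≡1 with p fz in eq
... | true  = fz , eq
... | false = let (x , px) = ∑Fin-[]≡1⇒∃ (p ∘ fs) ∑≡1 in fs x , px

∑Fin-[]≡1⇒unique : ∀ {n} (p : Fin n → Bool) → ∑Fin ([_] ∘ p) ≡ 1 →
                   ∀ x y → p x ≡ true → p y ≡ true → x ≡ y
∑Fin-[]≡1⇒unique p ∑≡1 fz     fz     px py = refl
∑Fin-[]≡1⇒unique p ∑≡1 fz     (fs y) px py rewrite px =
  ⊥-elim (true≢false (trans (sym py) (∑Fin-[]≡0⇒false (p ∘ fs) (ℕP.suc-injective ∑≡1) y)))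
∑Fin-[]≡1⇒unique p ∑≡1 (fs x) fz     px py = sym (∑Fin-[]≡1⇒unique p ∑≡1 fz (fs x) py px)
∑Fin-[]≡1⇒unique p ∑≡1 (fs x) (fs y) px py with p fz
... | true  = ⊥-elim (true≢false (trans (sym py) (∑Fin-[]≡0⇒false (p ∘ fs) (ℕP.suc-injective ∑≡1) y)))
... | false = cong fs (∑Fin-[]≡1⇒unique (p ∘ fs) ∑≡1 x y px py)

_≈ᶠ_ : ∀ {N n} → (Fin N → Fin n) → (Fin N → Fin n) → Bool
_≈ᶠ_ {N} h h' = all (λ j → h j == h' j) (allFin N)

≈ᶠ-true⇒≗ : ∀ {N n} (h h' : Fin N → Fin n) → h ≈ᶠ h' ≡ true → ∀ j → h j ≡ h' j
≈ᶠ-true⇒≗ h h' e j = ==-true⇒≡ {a = h j} {h' j} (all-allFin⁻ _ e j)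

≗⇒≈ᶠ-true : ∀ {N n} (h h' : Fin N → Fin n) → (∀ j → h j ≡ h' j) → h ≈ᶠ h' ≡ true
≗⇒≈ᶠ-true h h' e = all-allFin⁺ _ (λ j → subst (λ z → h j == z ≡ true) (e j) (==-refl (h j)))

≈ᶠ-◂ : ∀ {N n} c (g : Fin N → Fin n) h → (c ◂ g) ≈ᶠ h ≡ (c == h fz ∧ g ≈ᶠ (h ∘ fs))
≈ᶠ-◂ c g h = bool-ext
  (λ e → let c◂g≗h = ≈ᶠ-true⇒≗ (c ◂ g) h e in
    subst₂ (λ x y → (x ∧ y) ≡ true)
      (sym (subst (λ z → c == z ≡ true) (c◂g≗h fz) (==-refl c)))
      (sym (≗⇒≈ᶠ-true g (h ∘ fs) (c◂g≗h ∘ fs))) refl)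
  (λ e → ≗⇒≈ᶠ-true (c ◂ g) h λ
    { fz     → ==-true⇒≡ {a = c} {h fz} (∧-conicalˡ _ _ e)
    ; (fs j) → ≈ᶠ-true⇒≗ g (h ∘ fs) (∧-conicalʳ _ _ e) j })

∑Fun-[≈ᶠ] : ∀ N n (h : Fin N → Fin n) → ∑Fun N n (λ κ → [ κ ≈ᶠ h ]) ≡ 1
∑Fun-[≈ᶠ] zero    n h = refl
∑Fun-[≈ᶠ] (suc N) n h = begin
  ∑Fin (λ c → ∑Fun N n (λ g → [ (c ◂ g) ≈ᶠ h ]))
    ≡⟨ ∑Fin-cong (λ c → ∑Fun-cong N n (λ g → trans (cong [_] (≈ᶠ-◂ c g h)) ([∧]≡[]*[] (c == h fz) _))) ⟩
  ∑Fin (λ c → ∑Fun N n (λ g → [ c == h fz ] ℕ.* [ g ≈ᶠ (h ∘ fs) ]))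
    ≡⟨ ∑Fin-cong (λ c → ∑-*ˡ (funSummation N n) [ c == h fz ] _) ⟩
  ∑Fin (λ c → [ c == h fz ] ℕ.* ∑Fun N n (λ g → [ g ≈ᶠ (h ∘ fs) ]))
    ≡⟨ ∑Fin-cong (λ c → trans (cong ([ c == h fz ] ℕ.*_) (∑Fun-[≈ᶠ] N n (h ∘ fs))) (*-identityʳ _)) ⟩
  ∑Fin (λ c → [ c == h fz ])
    ≡⟨ ∑Fin-[==] (h fz) ⟩
  1 ∎
  where open ≡-Reasoning

-- Relabelling the vertices

isProper-true⇒ : ∀ {N n} (A : Fin N → Fin N → Bool) (κ : Fin N → Fin n) → isProper A κ ≡ true →
                 ∀ u v → κ u == κ v ≡ true → A u v ≡ false
isProper-true⇒ A κ proper u v κu=κv with all-allFin⁻ _ (all-allFin⁻ _ proper u) v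
... | not[Auv∧κu=κv] rewrite κu=κv = trans (sym (∧-identityʳ (A u v))) (not-true not[Auv∧κu=κv])

⇒isProper-true : ∀ {N n} (A : Fin N → Fin N → Bool) (κ : Fin N → Fin n) →
                 (∀ u v → κ u == κ v ≡ true → A u v ≡ false) → isProper A κ ≡ true
⇒isProper-true A κ h = all-allFin⁺ _ (λ u → all-allFin⁺ _ (λ v → no-clash u v))
  where
  no-clash : ∀ u v → not (A u v ∧ κ u == κ v) ≡ true
  no-clash u v with κ u == κ v in κu=κv
  ... | false = cong not (∧-zeroʳ (A u v))
  ... | true rewrite h u v κu=κv = refl

module VertexBijection {N N' : ℕ} (g : Fin N' → Fin N) (f : Fin N → Fin N')
                       (g∘f≗id : ∀ u → g (f u) ≡ u) (f∘g≗id : ∀ j → f (g j) ≡ j) where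

  ==-transpose : ∀ u j → u == g j ≡ j == f u
  ==-transpose u j = bool-ext
    (λ e → subst (λ z → j == z ≡ true)
                 (sym (trans (cong f (==-true⇒≡ {a = u} {g j} e)) (f∘g≗id j))) (==-refl j))
    (λ e → subst (λ z → u == z ≡ true)
                 (trans (sym (g∘f≗id u)) (cong g (sym (==-true⇒≡ {a = j} {f u} e)))) (==-refl u))

  ≈ᶠ-transpose : ∀ {n} (κ : Fin N → Fin n) κ' → κ' ≈ᶠ (κ ∘ g) ≡ κ ≈ᶠ (κ' ∘ f)
  ≈ᶠ-transpose κ κ' = bool-ext
    (λ e → ≗⇒≈ᶠ-true κ (κ' ∘ f) λ u →
       trans (cong κ (sym (g∘f≗id u))) (sym (≈ᶠ-true⇒≗ κ' (κ ∘ g) e (f u))))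
    (λ e → ≗⇒≈ᶠ-true κ' (κ ∘ g) λ j →
       trans (cong κ' (sym (f∘g≗id j))) (sym (≈ᶠ-true⇒≗ κ (κ' ∘ f) e (g j))))

  ∑Fin-reindex : (h : Fin N → ℕ) → ∑Fin h ≡ ∑Fin (h ∘ g)
  ∑Fin-reindex h = ∑-bijective-relation (finSummation N) (finSummation N') (∑Fin-swap (finSummation N'))
    (λ u j → u == g j)
    (λ u → trans (∑Fin-cong (λ j → cong [_] (==-transpose u j))) (∑Fin-[==] (f u)))
    (λ j → ∑Fin-[==] (g j))
    (λ u j e → cong h (==-true⇒≡ {a = u} {g j} e))

  module _ {n : ℕ} (κ : Fin N → Fin n) (κ' : Fin N' → Fin n) (κ'≗κ∘g : ∀ j → κ' j ≡ κ (g j)) where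

    countEq-reindex : ∀ i → countEq κ' i ≡ countEq κ i
    countEq-reindex i = begin
      countEq κ' i                    ≡⟨ count-allFin N' _ ⟩
      ∑Fin (λ j → [ κ' j == i ])      ≡⟨ ∑Fin-cong (λ j → cong (λ z → [ z == i ]) (κ'≗κ∘g j)) ⟩
      ∑Fin (λ j → [ κ (g j) == i ])   ≡⟨ ∑Fin-reindex (λ u → [ κ u == i ]) ⟨
      ∑Fin (λ u → [ κ u == i ])       ≡⟨ count-allFin N _ ⟨
      countEq κ i                     ∎
      where open ≡-Reasoning

    hasType-reindex : ∀ a → hasType a κ' ≡ hasType a κ
    hasType-reindex a = cong and (map-cong (λ i → cong (_≡ᵇ a i) (countEq-reindex i)) (allFin n))

    isProper-reindex : (A : Fin N → Fin N → Bool) (A' : Fin N' → Fin N' → Bool) →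
                       (∀ j j' → A' j j' ≡ A (g j) (g j')) → isProper A' κ' ≡ isProper A κ
    isProper-reindex A A' A'≡A∘g = bool-ext
      (λ proper' → ⇒isProper-true A κ λ u v κu=κv → begin
        A u v                 ≡⟨ cong₂ A (g∘f≗id u) (g∘f≗id v) ⟨
        A (g (f u)) (g (f v)) ≡⟨ A'≡A∘g (f u) (f v) ⟨
        A' (f u) (f v)        ≡⟨ isProper-true⇒ A' κ' proper' (f u) (f v) (subst₂ (λ x y → x == y ≡ true)
                                   (sym (κ'∘f≗κ u)) (sym (κ'∘f≗κ v)) κu=κv) ⟩
        false                 ∎)
      (λ proper → ⇒isProper-true A' κ' λ j j' κ'j=κ'j' → begin
        A' j j'               ≡⟨ A'≡A∘g j j' ⟩
        A (g j) (g j')        ≡⟨ isProper-true⇒ A κ proper (g j) (g j') (subst₂ (λ x y → x == y ≡ true)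
                                   (κ'≗κ∘g j) (κ'≗κ∘g j') κ'j=κ'j') ⟩
        false                 ∎)
      where
      open ≡-Reasoning
      κ'∘f≗κ : ∀ u → κ' (f u) ≡ κ u
      κ'∘f≗κ u = trans (κ'≗κ∘g (f u)) (cong κ (g∘f≗id u))

  coeffX-reindex : (A : Fin N → Fin N → Bool) (A' : Fin N' → Fin N' → Bool) →
                   (∀ j j' → A' j j' ≡ A (g j) (g j')) → ∀ n a → coeffX A n a ≡ coeffX A' n a
  coeffX-reindex A A' A'≡A∘g n a = begin
    coeffX A n a                                       ≡⟨ count-allFunctions N n _ ⟩
    ∑Fun N n (λ κ → [ isProper A κ ∧ hasType a κ ])
      ≡⟨ ∑-bijective-relation (funSummation N n) (funSummation N' n) (∑Fun-swap (funSummation N' n) N n)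
           (λ κ κ' → κ' ≈ᶠ (κ ∘ g))
           (λ κ → ∑Fun-[≈ᶠ] N' n (κ ∘ g))
           (λ κ' → trans (∑Fun-cong N n (λ κ → cong [_] (≈ᶠ-transpose κ κ'))) (∑Fun-[≈ᶠ] N n (κ' ∘ f)))
           invariant ⟩
    ∑Fun N' n (λ κ' → [ isProper A' κ' ∧ hasType a κ' ])   ≡⟨ count-allFunctions N' n _ ⟨
    coeffX A' n a                                      ∎
    where
    open ≡-Reasoning
    invariant : ∀ κ κ' → κ' ≈ᶠ (κ ∘ g) ≡ true →
                [ isProper A κ ∧ hasType a κ ] ≡ [ isProper A' κ' ∧ hasType a κ' ]
    invariant κ κ' e = let κ'≗κ∘g = ≈ᶠ-true⇒≗ κ' (κ ∘ g) e in
      cong [_] (sym (cong₂ _∧_ (isProper-reindex κ κ' κ'≗κ∘g A A' A'≡A∘g) (hasType-reindex κ κ' κ'≗κ∘g a)))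

-- The blocks of an equivalence relation

module Concatenation {X Y : Set} (B : X → List Y) where

  sizes : List X → List ℕ
  sizes = map (length ∘ B)

  elemAt : (rs : List X) → Fin (sum (sizes rs)) → Y
  elemAt (r ∷ rs) j with splitAt (length (B r)) j
  ... | inj₁ i  = lookup (B r) i
  ... | inj₂ j' = elemAt rs j'

  blockAt : (rs : List X) → Fin (sum (sizes rs)) → X
  blockAt (r ∷ rs) j with splitAt (length (B r)) j
  ... | inj₁ i  = r
  ... | inj₂ j' = blockAt rs j'

  elemAt-∈ : ∀ rs j → elemAt rs j ∈ B (blockAt rs j)
  elemAt-∈ (r ∷ rs) j with splitAt (length (B r)) j
  ... | inj₁ i  = ∈-lookup i
  ... | inj₂ j' = elemAt-∈ rs j'

  blockAt-∈ : ∀ rs j → blockAt rs j ∈ rs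
  blockAt-∈ (r ∷ rs) j with splitAt (length (B r)) j
  ... | inj₁ i  = here refl
  ... | inj₂ j' = there (blockAt-∈ rs j')

  partOf-sizes : (R : X → X → Bool) → (∀ x → R x x ≡ true) → (∀ x y → R x y ≡ R y x) →
                 ∀ rs → AllPairs (λ x y → R x y ≡ false) rs → ∀ j j' →
                 (partOf (sizes rs) j ≡ᵇ partOf (sizes rs) j') ≡ R (blockAt rs j) (blockAt rs j')
  partOf-sizes R R-refl R-sym (r ∷ rs) (r≁rs ∷ rs-apart) j j'
    with splitAt (length (B r)) j | splitAt (length (B r)) j'
  ... | inj₁ _ | inj₁ _  = sym (R-refl r)
  ... | inj₁ _ | inj₂ k' = sym (All.lookup r≁rs (blockAt-∈ rs k'))
  ... | inj₂ k | inj₁ _  = sym (trans (R-sym _ r) (All.lookup r≁rs (blockAt-∈ rs k)))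
  ... | inj₂ k | inj₂ k' = partOf-sizes R R-refl R-sym rs rs-apart k k'

  ∑Fin-lookup : ∀ (xs : List Y) (w : Y → ℕ) → ∑Fin (w ∘ lookup xs) ≡ ∑List xs w
  ∑Fin-lookup []       w = refl
  ∑Fin-lookup (x ∷ xs) w = cong (w x ℕ.+_) (∑Fin-lookup xs w)

  elemAt-↑ˡ : ∀ r rs i → elemAt (r ∷ rs) (i ↑ˡ sum (sizes rs)) ≡ lookup (B r) i
  elemAt-↑ˡ r rs i rewrite splitAt-↑ˡ (length (B r)) i (sum (sizes rs)) = refl

  elemAt-↑ʳ : ∀ r rs i → elemAt (r ∷ rs) (length (B r) ↑ʳ i) ≡ elemAt rs i
  elemAt-↑ʳ r rs i rewrite splitAt-↑ʳ (length (B r)) (sum (sizes rs)) i = refl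

  ∑Fin-elemAt : ∀ rs (w : Y → ℕ) → ∑Fin (w ∘ elemAt rs) ≡ ∑List rs (λ r → ∑List (B r) w)
  ∑Fin-elemAt []       w = refl
  ∑Fin-elemAt (r ∷ rs) w =
    trans (∑Fin-+ (length (B r)) (sum (sizes rs)) (w ∘ elemAt (r ∷ rs)))
          (cong₂ ℕ._+_ (trans (∑Fin-cong (cong w ∘ elemAt-↑ˡ r rs)) (∑Fin-lookup (B r) w))
                       (trans (∑Fin-cong (cong w ∘ elemAt-↑ʳ r rs)) (∑Fin-elemAt rs w)))

∈-filterᵇ⇒true : ∀ {X : Set} (p : X → Bool) {xs : List X} {x} → x ∈ filterᵇ p xs → p x ≡ true
∈-filterᵇ⇒true p {xs} x∈ = to T-≡ (proj₂ (∈-filter⁻ (T? ∘ p) {xs = xs} x∈))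

unique⇒apart : ∀ {X : Set} (R : X → X → Bool) {xs : List X} → Unique xs →
               (∀ {x y} → x ∈ xs → y ∈ xs → R x y ≡ true → x ≡ y) → AllPairs (λ x y → R x y ≡ false) xs
unique⇒apart R {[]}     []                R-inj = []
unique⇒apart R {x ∷ xs} (x∉xs ∷ xs-uniq) R-inj =
  All.tabulate apart ∷ unique⇒apart R xs-uniq (λ y∈ z∈ → R-inj (there y∈) (there z∈))
  where
  apart : ∀ {y} → y ∈ xs → R x y ≡ false
  apart {y} y∈ with R x y in Rxy
  ... | false = refl
  ... | true  = ⊥-elim (All.lookup x∉xs y∈ (R-inj (here refl) (there y∈) Rxy))

module EquivalenceClasses {m : ℕ} (R : Fin m → Fin m → Bool) (R-refl : ∀ u → R u u ≡ true)
  (R-sym : ∀ u v → R u v ≡ R v u) (R-trans : ∀ u v w → R u v ≡ true → R v w ≡ true → R u w ≡ true) where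

  isLeast : Fin m → Bool
  isLeast u = not (any (λ v → (toℕ v <ᵇ toℕ u) ∧ R v u) (allFin m))

  -- The same choice of one element per block as in blockSizes, so that
  -- blockSizes R is sizes leaders by definition.
  leaders : List (Fin m)
  leaders = filterᵇ isLeast (allFin m)

  class : Fin m → List (Fin m)
  class u = filterᵇ (R u) (allFin m)

  open Concatenation class

  isLeast⇒unrelated-below : ∀ r → isLeast r ≡ true → ∀ v → toℕ v < toℕ r → R v r ≡ false
  isLeast⇒unrelated-below r isLeast-r v v<r with R v r in Rvr
  ... | false = refl
  ... | true  = ⊥-elim (true≢false (trans (sym (any-allFin⁺ _ v v<r∧Rvr)) (not-true isLeast-r)))
    where v<r∧Rvr = subst (λ z → (z ∧ R v r) ≡ true) (sym (<⇒<ᵇ-true v<r)) Rvr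

  leader-exists : ∀ u → ∃ λ r → isLeast r ≡ true × R r u ≡ true
  leader-exists u = below (suc (toℕ u)) u ℕP.≤-refl
    where
    below : ∀ b u → toℕ u < b → ∃ λ r → isLeast r ≡ true × R r u ≡ true
    below (suc b) u u<b with isLeast u in isLeast-u
    ... | true  = u , isLeast-u , R-refl u
    ... | false =
      let (v , v<u∧Rvu)        = any-allFin⁻ _ (not-false isLeast-u)
          (r , isLeast-r , Rrv) = below b v (ℕP.≤-trans (<ᵇ-true⇒< (∧-conicalˡ _ _ v<u∧Rvu)) (ℕP.≤-pred u<b))
      in r , isLeast-r , R-trans r v u Rrv (∧-conicalʳ _ _ v<u∧Rvu)

  leader-unique : ∀ r r' u → isLeast r ≡ true → isLeast r' ≡ true → R r u ≡ true → R r' u ≡ true → r ≡ r'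
  leader-unique r r' u isLeast-r isLeast-r' Rru Rr'u with ℕP.<-cmp (toℕ r) (toℕ r')
  ... | tri< r<r' _ _ = ⊥-elim (true≢false (trans (sym (R-trans r u r' Rru (trans (R-sym u r') Rr'u)))
                                                   (isLeast⇒unrelated-below r' isLeast-r' r r<r')))
  ... | tri≈ _ r≡r' _ = toℕ-injective r≡r'
  ... | tri> _ _ r'<r = ⊥-elim (true≢false (trans (sym (R-trans r' u r Rr'u (trans (R-sym u r) Rru)))
                                                   (isLeast⇒unrelated-below r isLeast-r r' r'<r)))

  leaders-apart : AllPairs (λ x y → R x y ≡ false) leaders
  leaders-apart = unique⇒apart R (Unique.filter⁺ (T? ∘ isLeast) (Unique.allFin⁺ m))
    λ {x} {y} x∈ y∈ Rxy → leader-unique x y y (∈-filterᵇ⇒true isLeast {allFin m} x∈)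
                                               (∈-filterᵇ⇒true isLeast {allFin m} y∈) Rxy (R-refl y)

  enum : Fin (sum (sizes leaders)) → Fin m
  enum = elemAt leaders

  ∑List-class : ∀ r u → ∑List (class r) (λ y → [ y == u ]) ≡ [ R r u ]
  ∑List-class r u = begin
    ∑List (class r) (λ y → [ y == u ])                      ≡⟨ ∑List-filterᵇ (R r) (allFin m) _ ⟩
    ∑List (allFin m) (λ y → if R r y then [ y == u ] else 0) ≡⟨ ∑List-allFin m _ ⟩
    ∑Fin (λ y → if R r y then [ y == u ] else 0)            ≡⟨ ∑Fin-delta _ u off-u ⟩
    (if R r u then [ u == u ] else 0)                       ≡⟨ at-u (R r u) ⟩
    [ R r u ]                                               ∎
    where
    open ≡-Reasoning
    off-u : ∀ y → y ≢ u → (if R r y then [ y == u ] else 0) ≡ 0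
    off-u y y≢u with R r y
    ... | true  = cong [_] (≢⇒==-false y≢u)
    ... | false = refl
    at-u : ∀ b → (if b then [ u == u ] else 0) ≡ [ b ]
    at-u true  = cong [_] (==-refl u)
    at-u false = refl

  ∑Fin-[enum==] : ∀ u → ∑Fin (λ j → [ enum j == u ]) ≡ 1
  ∑Fin-[enum==] u = begin
    ∑Fin (λ j → [ enum j == u ])                             ≡⟨ ∑Fin-elemAt leaders _ ⟩
    ∑List leaders (λ r → ∑List (class r) (λ y → [ y == u ])) ≡⟨ ∑List-cong leaders (λ r → ∑List-class r u) ⟩
    ∑List leaders (λ r → [ R r u ])                          ≡⟨ ∑List-filterᵇ isLeast (allFin m) _ ⟩
    ∑List (allFin m) (λ r → if isLeast r then [ R r u ] else 0) ≡⟨ ∑List-allFin m _ ⟩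
    ∑Fin (λ r → if isLeast r then [ R r u ] else 0)        ≡⟨ ∑Fin-delta _ r₀ off-r₀ ⟩
    (if isLeast r₀ then [ R r₀ u ] else 0)                  ≡⟨ cong (λ b → if b then [ R r₀ u ] else 0) isLeast-r₀ ⟩
    [ R r₀ u ]                                              ≡⟨ cong [_] Rr₀u ⟩
    1                                                       ∎
    where
    open ≡-Reasoning
    r₀ = proj₁ (leader-exists u)
    isLeast-r₀ = proj₁ (proj₂ (leader-exists u))
    Rr₀u = proj₂ (proj₂ (leader-exists u))
    off-r₀ : ∀ r → r ≢ r₀ → (if isLeast r then [ R r u ] else 0) ≡ 0
    off-r₀ r r≢r₀ with isLeast r in isLeast-r | R r u in Rru
    ... | false | _     = refl
    ... | true  | false = refl
    ... | true  | true  = ⊥-elim (r≢r₀ (leader-unique r r₀ u isLeast-r isLeast-r₀ Rru Rr₀u))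

  index : Fin m → Fin (sum (sizes leaders))
  index u = proj₁ (∑Fin-[]≡1⇒∃ (λ j → enum j == u) (∑Fin-[enum==] u))

  enum∘index≗id : ∀ u → enum (index u) ≡ u
  enum∘index≗id u =
    ==-true⇒≡ {a = enum (index u)} {u} (proj₂ (∑Fin-[]≡1⇒∃ (λ j → enum j == u) (∑Fin-[enum==] u)))

  index∘enum≗id : ∀ j → index (enum j) ≡ j
  index∘enum≗id j = ∑Fin-[]≡1⇒unique (λ j' → enum j' == enum j) (∑Fin-[enum==] (enum j)) (index (enum j)) j
    (proj₂ (∑Fin-[]≡1⇒∃ (λ j' → enum j' == enum j) (∑Fin-[enum==] (enum j)))) (==-refl (enum j))

  R-resp : ∀ a a' b b' → R a a' ≡ true → R b b' ≡ true → R a b ≡ R a' b'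
  R-resp a a' b b' Raa' Rbb' = bool-ext
    (λ Rab → R-trans a' a b' (trans (R-sym a' a) Raa') (R-trans a b b' Rab Rbb'))
    (λ Ra'b' → R-trans a a' b Raa' (R-trans a' b' b Ra'b' (trans (R-sym b' b) Rbb')))

  multipartiteAdj-enum : ∀ j j' → multipartiteAdj (blockSizes R) j j' ≡ not (R (enum j) (enum j'))
  multipartiteAdj-enum j j' = cong not (trans (partOf-sizes R R-refl R-sym leaders leaders-apart j j')
    (R-resp _ _ _ _ (∈-filterᵇ⇒true (R (blockAt leaders j)) {allFin m} (elemAt-∈ leaders j))
                    (∈-filterᵇ⇒true (R (blockAt leaders j')) {allFin m} (elemAt-∈ leaders j'))))

  coeffR-blockSizes : ∀ n a → coeffR (blockSizes R) n a ≡ coeffX (λ u v → not (R u v)) n a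
  coeffR-blockSizes n a = sym (VertexBijection.coeffX-reindex enum index enum∘index≗id index∘enum≗id
    (λ u v → not (R u v)) (multipartiteAdj (blockSizes R)) multipartiteAdj-enum n a)

-- Greedy coarsening of a proper colouring

kernel : ∀ {m} → (Fin m → ℕ) → SetPartition m
kernel h = record
  { same       = λ u v → h u ≡ᵇ h v
  ; same-refl  = λ u → ≡ᵇ-refl (h u)
  ; same-sym   = λ u v → bool-ext (≡⇒≡ᵇ-true (h v) (h u) ∘ sym ∘ ≡ᵇ-true⇒≡ (h u) (h v))
                                  (≡⇒≡ᵇ-true (h u) (h v) ∘ sym ∘ ≡ᵇ-true⇒≡ (h v) (h u))
  ; same-trans = λ u v w e e' →
      ≡⇒≡ᵇ-true (h u) (h w) (trans (≡ᵇ-true⇒≡ (h u) (h v) e) (≡ᵇ-true⇒≡ (h v) (h w) e'))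
  }

search : (ℕ → Bool) → ℕ → ℕ
search p zero    = 0
search p (suc b) = if p 0 then 0 else suc (search (p ∘ suc) b)

search-true : ∀ (p : ℕ → Bool) b → p b ≡ true → p (search p b) ≡ true
search-true p zero    pb = pb
search-true p (suc b) pb with p 0 in p0
... | true  = p0
... | false = search-true (p ∘ suc) b pb

search-least : ∀ (p : ℕ → Bool) b j → j < search p b → p j ≡ false
search-least p (suc b) j j<s with p 0 in p0
search-least p (suc b) j       ()        | true
search-least p (suc b) zero    _         | false = p0
search-least p (suc b) (suc j) (s≤s j<s) | false = search-least (p ∘ suc) b j j<s

search-≤ : ∀ (p : ℕ → Bool) b → search p b ≤ b
search-≤ p zero    = z≤n
search-≤ p (suc b) with p 0
... | true  = z≤n
... | false = s≤s (search-≤ (p ∘ suc) b)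

allBelow : ℕ → (ℕ → Bool) → Bool
allBelow zero    p = true
allBelow (suc c) p = allBelow c p ∧ p c

allBelow-true⇒ : ∀ c p → allBelow c p ≡ true → ∀ c' → c' < c → p c' ≡ true
allBelow-true⇒ (suc c) p all-p c' c'<1+c with ℕP.m≤n⇒m<n∨m≡n (ℕP.≤-pred c'<1+c)
... | inj₁ c'<c  = allBelow-true⇒ c p (∧-conicalˡ _ _ all-p) c' c'<c
... | inj₂ refl = ∧-conicalʳ _ _ all-p

⇒allBelow-true : ∀ c p → (∀ c' → c' < c → p c' ≡ true) → allBelow c p ≡ true
⇒allBelow-true zero    p h = refl
⇒allBelow-true (suc c) p h
  rewrite ⇒allBelow-true c p (λ c' c'<c → h c' (ℕP.m≤n⇒m≤1+n c'<c)) | h c ℕP.≤-refl = refl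

allBelow-false⇒ : ∀ c p → allBelow c p ≡ false → ∃ λ c' → c' < c × p c' ≡ false
allBelow-false⇒ (suc c) p none with allBelow c p in all-p
... | false = let (c' , c'<c , pc') = allBelow-false⇒ c p all-p in c' , ℕP.m≤n⇒m≤1+n c'<c , pc'
... | true  = c , ℕP.≤-refl , none

module Greedy {m n : ℕ} (G : Graph m) (κ : Fin m → Fin n)
              (κ-proper : ∀ u v → κ u == κ v ≡ true → adj G u v ≡ false) where

  col : Fin m → ℕ
  col u = toℕ (κ u)

  linked : ℕ → ℕ → Bool
  linked c c' = any (λ x → any (λ y → ((col x ≡ᵇ c) ∧ (col y ≡ᵇ c')) ∧ adj G x y) (allFin m)) (allFin m)

  linked-intro : ∀ x y → adj G x y ≡ true → linked (col x) (col y) ≡ true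
  linked-intro x y xy = any-allFin⁺ _ x (any-allFin⁺ _ y
    (subst₂ (λ a b → ((a ∧ b) ∧ adj G x y) ≡ true) (sym (≡ᵇ-refl (col x))) (sym (≡ᵇ-refl (col y))) xy))

  linked-elim : ∀ c c' → linked c c' ≡ true → ∃₂ λ x y → col x ≡ c × col y ≡ c' × adj G x y ≡ true
  linked-elim c c' e =
    let (x , ex) = any-allFin⁻ _ e
        (y , ey) = any-allFin⁻ _ ex
        colours  = ∧-conicalˡ _ _ ey
    in x , y , ≡ᵇ-true⇒≡ _ _ (∧-conicalˡ _ _ colours) , ≡ᵇ-true⇒≡ _ _ (∧-conicalʳ _ _ colours)
         , ∧-conicalʳ _ _ ey

  unlinked⇒nonadjacent : ∀ x y → linked (col x) (col y) ≡ false → adj G x y ≡ false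
  unlinked⇒nonadjacent x y unlinked with adj G x y in xy
  ... | false = refl
  ... | true  = ⊥-elim (true≢false (trans (sym (linked-intro x y xy)) unlinked))

  fits : ℕ → (ℕ → ℕ) → ℕ → Bool
  fits c groupOf j = allBelow c (λ c' → not ((groupOf c' ≡ᵇ j) ∧ linked c c'))

  -- Colour c joins the least group containing no colour below c that is linked to c.
  -- groupsBelow c tabulates the groups of the colours below c, which makes this
  -- course-of-values recursion structural.
  groupsBelow : ℕ → ℕ → ℕ
  groupsBelow zero    c' = 0
  groupsBelow (suc c) c' = if c' <ᵇ c then groupsBelow c c' else search (fits c (groupsBelow c)) c

  group : ℕ → ℕ
  group c = search (fits c (groupsBelow c)) c

  groupsBelow≡group : ∀ c c' → c' < c → groupsBelow c c' ≡ group c'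
  groupsBelow≡group (suc c) c' c'<1+c with c' <ᵇ c in c'<ᵇc
  ... | true  = groupsBelow≡group c c' (<ᵇ-true⇒< c'<ᵇc)
  ... | false with ℕP.m≤n⇒m<n∨m≡n (ℕP.≤-pred c'<1+c)
  ...   | inj₁ c'<c = ⊥-elim (true≢false (trans (sym (<⇒<ᵇ-true c'<c)) c'<ᵇc))
  ...   | inj₂ refl = refl

  group-≤ : ∀ c → group c ≤ c
  group-≤ c = search-≤ (fits c (groupsBelow c)) c

  fits-fresh : ∀ c → fits c (groupsBelow c) c ≡ true
  fits-fresh c = ⇒allBelow-true c _ λ c' c'<c →
    subst (λ z → not ((z ≡ᵇ c) ∧ linked c c') ≡ true) (sym (groupsBelow≡group c c' c'<c))
      (cong (λ b → not (b ∧ linked c c'))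
            (≢⇒≡ᵇ-false λ gc'≡c → ℕP.<-irrefl gc'≡c (ℕP.≤-<-trans (group-≤ c') c'<c)))

  group-fits : ∀ c → fits c (groupsBelow c) (group c) ≡ true
  group-fits c = search-true (fits c (groupsBelow c)) c (fits-fresh c)

  same-group⇒unlinked : ∀ c c' → c' < c → group c' ≡ group c → linked c c' ≡ false
  same-group⇒unlinked c c' c'<c same with allBelow-true⇒ c _ (group-fits c) c' c'<c
  ... | no-clash rewrite groupsBelow≡group c c' c'<c | same | ≡ᵇ-refl (group c) = not-true no-clash

  lower-group⇒linked : ∀ c j → j < group c → ∃₂ λ x y → col x ≡ c × group (col y) ≡ j × adj G x y ≡ true
  lower-group⇒linked c j j<gc =
    let (c' , c'<c , clash) = allBelow-false⇒ c _ (search-least _ c j j<gc)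
        (x , y , x∈c , y∈c' , xy) = linked-elim c c' (∧-conicalʳ _ _ (not-false clash))
        gc'≡j = trans (sym (groupsBelow≡group c c' c'<c)) (≡ᵇ-true⇒≡ _ _ (∧-conicalˡ _ _ (not-false clash)))
    in x , y , x∈c , trans (cong group y∈c') gc'≡j , xy

  partition : SetPartition m
  partition = kernel (group ∘ col)

  coarsens : ∀ u v → κ u == κ v ≡ true → same partition u v ≡ true
  coarsens u v κu=κv = ≡⇒≡ᵇ-true _ _ (cong group (≡ᵇ-true⇒≡ (col u) (col v) κu=κv))

  stable : ∀ u v → same partition u v ≡ true → adj G u v ≡ false
  stable u v same-uv with ℕP.<-cmp (col u) (col v)
  ... | tri≈ _ cu≡cv _ = κ-proper u v (≡⇒≡ᵇ-true _ _ cu≡cv)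
  ... | tri< cu<cv _ _ = trans (adj-sym G u v) (unlinked⇒nonadjacent v u
                           (same-group⇒unlinked (col v) (col u) cu<cv (≡ᵇ-true⇒≡ _ _ same-uv)))
  ... | tri> _ _ cv<cu = unlinked⇒nonadjacent u v
                           (same-group⇒unlinked (col u) (col v) cv<cu (sym (≡ᵇ-true⇒≡ _ _ same-uv)))

  maximal : ∀ u v → same partition u v ≡ false →
            ∃₂ λ x y → same partition u x ≡ true × same partition v y ≡ true × adj G x y ≡ true
  maximal u v different with ℕP.<-cmp (group (col u)) (group (col v))
  ... | tri≈ _ gu≡gv _ = ⊥-elim (true≢false (trans (sym (≡⇒≡ᵇ-true _ _ gu≡gv)) different))
  ... | tri< gu<gv _ _ =
    let (x , y , x∈v , gy≡gu , xy) = lower-group⇒linked (col v) (group (col u)) gu<gv in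
    y , x , ≡⇒≡ᵇ-true _ _ (sym gy≡gu) , ≡⇒≡ᵇ-true _ _ (cong group (sym x∈v)) , trans (adj-sym G y x) xy
  ... | tri> _ _ gv<gu =
    let (x , y , x∈u , gy≡gv , xy) = lower-group⇒linked (col u) (group (col v)) gv<gu in
    x , y , ≡⇒≡ᵇ-true _ _ (cong group (sym x∈u)) , ≡⇒≡ᵇ-true _ _ (sym gy≡gv) , xy

proper⇒coarsening-maxStable : ∀ {m n} (G : Graph m) (κ : Fin m → Fin n) → isProper (adj G) κ ≡ true →
  ∃ λ π → IsMaxStablePartition G π × (∀ u v → κ u == κ v ≡ true → same π u v ≡ true)
proper⇒coarsening-maxStable G κ proper = partition , (stable , maximal) , coarsens
  where open Greedy G κ (isProper-true⇒ (adj G) κ proper)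

-- Inclusion–exclusion over subsets of [k]

_⊆ᵇ_ : ∀ {k} → Subset k → Subset k → Bool
_⊆ᵇ_ {zero}  S T = true
_⊆ᵇ_ {suc k} S T = (not (S fz) ∨ T fz) ∧ ((S ∘ fs) ⊆ᵇ (T ∘ fs))

⇒⊆ᵇ-true : ∀ {k} (S T : Subset k) → (∀ i → S i ≡ true → T i ≡ true) → S ⊆ᵇ T ≡ true
⇒⊆ᵇ-true {zero}  S T S⊆T = refl
⇒⊆ᵇ-true {suc k} S T S⊆T with S fz in S0
... | false = ⇒⊆ᵇ-true (S ∘ fs) (T ∘ fs) (S⊆T ∘ fs)
... | true rewrite S⊆T fz S0 = ⇒⊆ᵇ-true (S ∘ fs) (T ∘ fs) (S⊆T ∘ fs)

⊆ᵇ-true⇒ : ∀ {k} (S T : Subset k) → S ⊆ᵇ T ≡ true → ∀ i → S i ≡ true → T i ≡ true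
⊆ᵇ-true⇒ S T S⊆T fz     Si with ∧-conicalˡ (not (S fz) ∨ T fz) _ S⊆T
... | head rewrite Si = head
⊆ᵇ-true⇒ S T S⊆T (fs i) Si = ⊆ᵇ-true⇒ (S ∘ fs) (T ∘ fs) (∧-conicalʳ _ _ S⊆T) i Si

isEmptyᵇ : ∀ {k} → Subset k → Bool
isEmptyᵇ {zero}  T = true
isEmptyᵇ {suc k} T = not (T fz) ∧ isEmptyᵇ (T ∘ fs)

isEmptyᵇ-false⇒ : ∀ {k} (T : Subset k) → isEmptyᵇ T ≡ false → ∃ λ i → T i ≡ true
isEmptyᵇ-false⇒ {suc k} T nonempty with T fz in T0
... | true  = fz , T0
... | false = let (i , Ti) = isEmptyᵇ-false⇒ (T ∘ fs) nonempty in fs i , Ti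

∈⇒isEmptyᵇ-false : ∀ {k} (T : Subset k) i → T i ≡ true → isEmptyᵇ T ≡ false
∈⇒isEmptyᵇ-false T fz     Ti rewrite Ti = refl
∈⇒isEmptyᵇ-false T (fs i) Ti rewrite ∈⇒isEmptyᵇ-false (T ∘ fs) i Ti = ∧-zeroʳ _

card-◂ : ∀ {k} b (S : Subset k) → card (b ◂ S) ≡ [ b ] ℕ.+ card S
card-◂ {k} b S = trans (count-allFin (suc k) (b ◂ S)) (cong ([ b ] ℕ.+_) (sym (count-allFin k S)))

∑Subsets : ∀ k → (Subset k → ℤ) → ℤ
∑Subsets k = ℤ∑.∑List (allSubsets k)

∑Subsets-card-◂ : ∀ k (w : ℕ → ℤ) (g : Subset (suc k) → ℤ) →
  ∑Subsets (suc k) (λ S → w (card S) ℤ.* g S)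
    ≡ ∑Subsets k (λ S → w (suc (card S)) ℤ.* g (true ◂ S)) ℤ.+ ∑Subsets k (λ S → w (card S) ℤ.* g (false ◂ S))
∑Subsets-card-◂ k w g = begin
  ∑Subsets (suc k) F
    ≡⟨ ℤ∑.∑List-concatMap (λ b → map (b ◂_) (allSubsets k)) (true ∷ false ∷ []) F ⟩
  ℤ∑.∑List (map (true ◂_) (allSubsets k)) F ℤ.+ (ℤ∑.∑List (map (false ◂_) (allSubsets k)) F ℤ.+ + 0)
    ≡⟨ cong₂ ℤ._+_ (ℤ∑.∑List-map (true ◂_) (allSubsets k) F)
                   (trans (ℤP.+-identityʳ _) (ℤ∑.∑List-map (false ◂_) (allSubsets k) F)) ⟩
  ∑Subsets k (F ∘ (true ◂_)) ℤ.+ ∑Subsets k (F ∘ (false ◂_))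
    ≡⟨ cong₂ ℤ._+_ (ℤ∑.∑List-cong (allSubsets k) (λ S → cong (λ c → w c ℤ.* g (true ◂ S)) (card-◂ true S)))
                   (ℤ∑.∑List-cong (allSubsets k) (λ S → cong (λ c → w c ℤ.* g (false ◂ S)) (card-◂ false S))) ⟩
  ∑Subsets k (λ S → w (suc (card S)) ℤ.* g (true ◂ S)) ℤ.+ ∑Subsets k (λ S → w (card S) ℤ.* g (false ◂ S)) ∎
  where
  open ≡-Reasoning
  F = λ S → w (card S) ℤ.* g S

∑List-neg : ∀ {X : Set} (xs : List X) (h : X → ℤ) → ℤ∑.∑List xs (λ x → - h x) ≡ - ℤ∑.∑List xs h
∑List-neg []       h = refl
∑List-neg (x ∷ xs) h = trans (cong (ℤ._+_ (- h x)) (∑List-neg xs h)) (sym (ℤP.neg-distrib-+ (h x) _))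

∑List-≡0 : ∀ {X : Set} (xs : List X) (h : X → ℤ) → (∀ x → h x ≡ + 0) → ℤ∑.∑List xs h ≡ + 0
∑List-≡0 xs h h≡0 = trans (ℤ∑.∑List-cong xs h≡0) (ℤ∑.∑List-ε xs)

−1^_ : ℕ → ℤ
−1^ zero  = + 1
−1^ suc c = - (−1^ c)

∑Subsets-alternating : ∀ k (T : Subset k) → ∑Subsets k (λ S → −1^ card S ℤ.* + [ S ⊆ᵇ T ]) ≡ + [ isEmptyᵇ T ]
∑Subsets-alternating zero    T = refl
∑Subsets-alternating (suc k) T with T fz | ∑Subsets-card-◂ k −1^_ (λ S → + [ S ⊆ᵇ T ])
... | true  | split = begin
  _                                                  ≡⟨ split ⟩
  ∑Subsets k (λ S → - (−1^ card S) ℤ.* + [ S ⊆ᵇ T′ ]) ℤ.+ A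
    ≡⟨ cong (ℤ._+ A) (trans (ℤ∑.∑List-cong (allSubsets k) (λ S → sym (ℤP.neg-distribˡ-* (−1^ card S) _)))
                            (∑List-neg (allSubsets k) _)) ⟩
  - A ℤ.+ A                                          ≡⟨ ℤP.+-inverseˡ A ⟩
  + 0                                                ∎
  where
  open ≡-Reasoning
  T′ = T ∘ fs
  A = ∑Subsets k (λ S → −1^ card S ℤ.* + [ S ⊆ᵇ T′ ])
... | false | split = begin
  _                                                  ≡⟨ split ⟩
  ∑Subsets k (λ S → −1^ suc (card S) ℤ.* + 0) ℤ.+ A
    ≡⟨ cong (ℤ._+ A) (∑List-≡0 (allSubsets k) _ (λ S → ℤP.*-zeroʳ (−1^ suc (card S)))) ⟩
  + 0 ℤ.+ A                                          ≡⟨ ℤP.+-identityˡ A ⟩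
  A                                                  ≡⟨ ∑Subsets-alternating k (T ∘ fs) ⟩
  + [ isEmptyᵇ (T ∘ fs) ]                            ∎
  where
  open ≡-Reasoning
  A = ∑Subsets k (λ S → −1^ card S ℤ.* + [ S ⊆ᵇ (T ∘ fs) ])

∑Subsets-card≡0 : ∀ k (T : Subset k) → ∑Subsets k (λ S → + [ card S ≡ᵇ 0 ] ℤ.* + [ S ⊆ᵇ T ]) ≡ + 1
∑Subsets-card≡0 zero    T = refl
∑Subsets-card≡0 (suc k) T = begin
  ∑Subsets (suc k) _                                 ≡⟨ ∑Subsets-card-◂ k (λ c → + [ c ≡ᵇ 0 ]) (λ S → + [ S ⊆ᵇ T ]) ⟩
  ∑Subsets k (λ S → + 0) ℤ.+ A                       ≡⟨ cong (ℤ._+ A) (ℤ∑.∑List-ε (allSubsets k)) ⟩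
  + 0 ℤ.+ A                                          ≡⟨ ℤP.+-identityˡ A ⟩
  A                                                  ≡⟨ ∑Subsets-card≡0 k (T ∘ fs) ⟩
  + 1                                                ∎
  where
  open ≡-Reasoning
  A = ∑Subsets k (λ S → + [ card S ≡ᵇ 0 ] ℤ.* + [ S ⊆ᵇ (T ∘ fs) ])

weight : ℕ → ℤ
weight c = if not (c ≡ᵇ 0) then signPred c else + 0

weight+−1^≡[≡0] : ∀ c → weight c ℤ.+ −1^ c ≡ + [ c ≡ᵇ 0 ]
weight+−1^≡[≡0] zero          = refl
weight+−1^≡[≡0] (suc zero)    = refl
weight+−1^≡[≡0] (suc (suc c)) =
  trans (sym (ℤP.neg-distrib-+ (signPred (suc c)) (−1^ suc c))) (cong -_ (weight+−1^≡[≡0] (suc c)))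

inclusion-exclusion : ∀ k (T : Subset k) →
  ∑Subsets k (λ S → weight (card S) ℤ.* + [ S ⊆ᵇ T ]) ≡ + [ not (isEmptyᵇ T) ]
inclusion-exclusion k T = begin
  A                                  ≡⟨ //-rightDividesʳ B A ⟨
  (A ℤ.+ B) ℤ.- B                    ≡⟨ cong₂ ℤ._-_ A+B≡1 (∑Subsets-alternating k T) ⟩
  + 1 ℤ.- + [ isEmptyᵇ T ]           ≡⟨ 1-[b]≡[not-b] (isEmptyᵇ T) ⟩
  + [ not (isEmptyᵇ T) ]             ∎
  where
  open ≡-Reasoning
  open import Algebra.Properties.AbelianGroup ℤP.+-0-abelianGroup using (//-rightDividesʳ)
  weighted : (ℕ → ℤ) → ℤ
  weighted w = ∑Subsets k (λ S → w (card S) ℤ.* + [ S ⊆ᵇ T ])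
  A = weighted weight
  B = weighted −1^_
  A+B≡1 : A ℤ.+ B ≡ + 1
  A+B≡1 = begin
    A ℤ.+ B                         ≡⟨ ℤ∑.∑List-⊕ (allSubsets k) _ _ ⟨
    ∑Subsets k (λ S → weight (card S) ℤ.* + [ S ⊆ᵇ T ] ℤ.+ −1^ card S ℤ.* + [ S ⊆ᵇ T ])
      ≡⟨ ℤ∑.∑List-cong (allSubsets k) (λ S → trans (sym (ℤP.*-distribʳ-+ (+ [ S ⊆ᵇ T ]) (weight (card S)) _))
                                                    (cong (ℤ._* + [ S ⊆ᵇ T ]) (weight+−1^≡[≡0] (card S)))) ⟩
    weighted (λ c → + [ c ≡ᵇ 0 ])   ≡⟨ ∑Subsets-card≡0 k T ⟩
    + 1                             ∎
  1-[b]≡[not-b] : ∀ b → + 1 ℤ.- + [ b ] ≡ + [ not b ]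
  1-[b]≡[not-b] true  = refl
  1-[b]≡[not-b] false = refl

-- Colourings refining the maximal stable partitions

module _ {m k : ℕ} (M : Fin k → SetPartition m) where

  meet-true⇒ : ∀ S u v → meet M S u v ≡ true → ∀ i → S i ≡ true → same (M i) u v ≡ true
  meet-true⇒ S u v uv i Si with all-allFin⁻ _ uv i
  ... | uv-in-i rewrite Si = uv-in-i

  ⇒meet-true : ∀ S u v → (∀ i → S i ≡ true → same (M i) u v ≡ true) → meet M S u v ≡ true
  ⇒meet-true S u v h = all-allFin⁺ _ in-each
    where
    in-each : ∀ i → (if S i then same (M i) u v else true) ≡ true
    in-each i with S i in Si
    ... | true  = h i Si
    ... | false = refl

  module _ (S : Subset k) where

    meet-refl : ∀ u → meet M S u u ≡ true
    meet-refl u = ⇒meet-true S u u (λ i _ → same-refl (M i) u)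

    meet-sym : ∀ u v → meet M S u v ≡ meet M S v u
    meet-sym u v = bool-ext
      (λ uv → ⇒meet-true S v u (λ i Si → trans (same-sym (M i) v u) (meet-true⇒ S u v uv i Si)))
      (λ vu → ⇒meet-true S u v (λ i Si → trans (same-sym (M i) u v) (meet-true⇒ S v u vu i Si)))

    meet-trans : ∀ u v w → meet M S u v ≡ true → meet M S v w ≡ true → meet M S u w ≡ true
    meet-trans u v w uv vw = ⇒meet-true S u w
      (λ i Si → same-trans (M i) u v w (meet-true⇒ S u v uv i Si) (meet-true⇒ S v w vw i Si))

  -- i ∈ refinedBy κ iff every colour class of κ lies inside a block of M i.
  refinedBy : ∀ {n} → (Fin m → Fin n) → Subset k
  refinedBy κ i = isProper (λ u v → not (same (M i) u v)) κ

  isProper-¬meet : ∀ {n} (κ : Fin m → Fin n) S → isProper (λ u v → not (meet M S u v)) κ ≡ S ⊆ᵇ refinedBy κ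
  isProper-¬meet κ S = bool-ext
    (λ proper → ⇒⊆ᵇ-true S _ λ i Si → ⇒isProper-true _ κ λ u v κuv →
       cong not (meet-true⇒ S u v (not-false (isProper-true⇒ _ κ proper u v κuv)) i Si))
    (λ S⊆ → ⇒isProper-true _ κ λ u v κuv → cong not (⇒meet-true S u v λ i Si →
       not-false (isProper-true⇒ _ κ (⊆ᵇ-true⇒ S _ S⊆ i Si) u v κuv)))

  module _ (G : Graph m) (maxStable : ∀ i → IsMaxStablePartition G (M i))
           (complete : ∀ π → IsMaxStablePartition G π → ∃ λ i → π ≈P M i) where

    isProper-adj : ∀ {n} (κ : Fin m → Fin n) → isProper (adj G) κ ≡ not (isEmptyᵇ (refinedBy κ))
    isProper-adj κ = bool-ext
      (λ proper →
        let (π , maxStable-π , κ⊆π) = proper⇒coarsening-maxStable G κ proper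
            (i , π≈Mi)             = complete π maxStable-π
        in cong not (∈⇒isEmptyᵇ-false (refinedBy κ) i (⇒isProper-true _ κ λ u v κuv →
             cong not (trans (sym (π≈Mi u v)) (κ⊆π u v κuv)))))
      (λ nonempty →
        let (i , κ⊆Mi) = isEmptyᵇ-false⇒ (refinedBy κ) (not-true nonempty)
        in ⇒isProper-true (adj G) κ λ u v κuv →
             proj₁ (maxStable i) u v (not-false (isProper-true⇒ _ κ κ⊆Mi u v κuv)))

    ∑Subsets-isProper : ∀ {n} (κ : Fin m → Fin n) b →
      ∑Subsets k (λ S → weight (card S) ℤ.* + [ isProper (λ u v → not (meet M S u v)) κ ∧ b ])
        ≡ + [ isProper (adj G) κ ∧ b ]
    ∑Subsets-isProper κ false = begin
      ∑Subsets k (λ S → weight (card S) ℤ.* + [ isProper _ κ ∧ false ])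
        ≡⟨ ∑List-≡0 (allSubsets k) _ (λ S → trans (cong (λ b → weight (card S) ℤ.* + [ b ]) (∧-zeroʳ _))
                                                  (ℤP.*-zeroʳ (weight (card S)))) ⟩
      + 0                                     ≡⟨ cong (λ b → + [ b ]) (∧-zeroʳ _) ⟨
      + [ isProper (adj G) κ ∧ false ]       ∎
      where open ≡-Reasoning
    ∑Subsets-isProper κ true = begin
      ∑Subsets k (λ S → weight (card S) ℤ.* + [ isProper _ κ ∧ true ])
        ≡⟨ ℤ∑.∑List-cong (allSubsets k) (λ S →
             cong (λ b → weight (card S) ℤ.* + [ b ]) (trans (∧-identityʳ _) (isProper-¬meet κ S))) ⟩
      ∑Subsets k (λ S → weight (card S) ℤ.* + [ S ⊆ᵇ refinedBy κ ])
        ≡⟨ inclusion-exclusion k (refinedBy κ) ⟩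
      + [ not (isEmptyᵇ (refinedBy κ)) ]
        ≡⟨ cong (λ b → + [ b ]) (trans (∧-identityʳ _) (isProper-adj κ)) ⟨
      + [ isProper (adj G) κ ∧ true ]        ∎
      where open ≡-Reasoning

  ∑Colourings-meet : ∀ S n a →
    ℤ∑.∑Fun m n (λ κ → weight (card S) ℤ.* + [ isProper (λ u v → not (meet M S u v)) κ ∧ hasType a κ ])
      ≡ weight (card S) ℤ.* + coeffR (blockSizes (meet M S)) n a
  ∑Colourings-meet S n a = begin
    ℤ∑.∑Fun m n (λ κ → weight (card S) ℤ.* + [ P κ ])  ≡⟨ scale-hom.∑Fun-hom (weight (card S)) m n _ ⟨
    weight (card S) ℤ.* ℤ∑.∑Fun m n (λ κ → + [ P κ ])  ≡⟨ cong (weight (card S) ℤ.*_) (pos-hom.∑Fun-hom m n _) ⟨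
    weight (card S) ℤ.* + ∑Fun m n (λ κ → [ P κ ])     ≡⟨ cong (λ c → weight (card S) ℤ.* + c) (count-allFunctions m n P) ⟨
    weight (card S) ℤ.* + coeffX (λ u v → not (meet M S u v)) n a
      ≡⟨ cong (λ c → weight (card S) ℤ.* + c)
              (EquivalenceClasses.coeffR-blockSizes (meet M S) (meet-refl S) (meet-sym S) (meet-trans S) n a) ⟨
    weight (card S) ℤ.* + coeffR (blockSizes (meet M S)) n a ∎
    where
    open ≡-Reasoning
    P : (Fin m → Fin n) → Bool
    P κ = isProper (λ u v → not (meet M S u v)) κ ∧ hasType a κ

  coeffRHS-weighted : ∀ n a →
    coeffRHS M n a ≡ ∑Subsets k (λ S → weight (card S) ℤ.* + coeffR (blockSizes (meet M S)) n a)
  coeffRHS-weighted n a = begin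
    coeffRHS M n a
      ≡⟨ ℤ∑.∑List≡foldr (filterᵇ nonempty (allSubsets k)) term ⟨
    ℤ∑.∑List (filterᵇ nonempty (allSubsets k)) term
      ≡⟨ ℤ∑.∑List-filterᵇ nonempty (allSubsets k) term ⟩
    ℤ∑.∑List (allSubsets k) (λ S → if nonempty S then term S else + 0)
      ≡⟨ ℤ∑.∑List-cong (allSubsets k) (λ S → weight-* (card S) _) ⟨
    ∑Subsets k (λ S → weight (card S) ℤ.* + coeffR (blockSizes (meet M S)) n a) ∎
    where
    open ≡-Reasoning
    nonempty : Subset k → Bool
    nonempty S = not (card S ≡ᵇ 0)
    term : Subset k → ℤ
    term S = signPred (card S) ℤ.* + coeffR (blockSizes (meet M S)) n a
    weight-* : ∀ c x → weight c ℤ.* x ≡ (if not (c ≡ᵇ 0) then signPred c ℤ.* x else + 0)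
    weight-* zero    x = refl
    weight-* (suc c) x = refl

corollary3p3 : (m : ℕ) (G : Graph m) (k : ℕ) (M : Fin k → SetPartition m) →
    (∀ i → IsMaxStablePartition G (M i)) →
    (∀ i j → M i ≈P M j → i ≡ j) →
    (∀ π → IsMaxStablePartition G π → ∃ λ i → π ≈P M i) →
    (n : ℕ) (a : Fin n → ℕ) →
    + coeffX (adj G) n a ≡ coeffRHS M n a
corollary3p3 m G k M maxStable _ complete n a = begin
  + coeffX (adj G) n a
    ≡⟨ trans (cong +_ (count-allFunctions m n _)) (pos-hom.∑Fun-hom m n _) ⟩
  ℤ∑.∑Fun m n (λ κ → + [ isProper (adj G) κ ∧ hasType a κ ])
    ≡⟨ ℤ∑.∑Fun-cong m n (λ κ → ∑Subsets-isProper M G maxStable complete κ (hasType a κ)) ⟨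
  ℤ∑.∑Fun m n (λ κ → ∑Subsets k (λ S → weight (card S) ℤ.* + [ properFor S κ ]))
    ≡⟨ ℤ∑.∑List-swap (ℤ∑.funSummation m n) (allSubsets k) _ ⟨
  ∑Subsets k (λ S → ℤ∑.∑Fun m n (λ κ → weight (card S) ℤ.* + [ properFor S κ ]))
    ≡⟨ ℤ∑.∑List-cong (allSubsets k) (λ S → ∑Colourings-meet M S n a) ⟩
  ∑Subsets k (λ S → weight (card S) ℤ.* + coeffR (blockSizes (meet M S)) n a)
    ≡⟨ coeffRHS-weighted M n a ⟨
  coeffRHS M n a ∎
  where
  open ≡-Reasoning
  properFor : Subset k → (Fin m → Fin n) → Bool
  properFor S κ = isProper (λ u v → not (meet M S u v)) κ ∧ hasType a κ
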